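{- Let $M$ be a $\lambda$-term. If there exist $a\in T_r(M)$ and $m\in\mathbb N$ such that $H_r^m(a)$ is a rigid head-normal form different from $0$, then $H^m(M)$ is a head-normal form.
   Context: Rigid resource terms: $a ::= x\mid \lambda x.a\mid \langle c\rangle\vec d\mid 0$, $\vec d=(d_1,\dots,d_n)$ a finite list of rigid terms; up to $\alpha$; $0$ absorbing ($\lambda x.0=0$, $\langle0\rangle\vec d=0$, a list containing $0$ equals $0$). Rigid substitution $a[\vec b/x]$, $\vec b=(b_1,\dots,b_k)$: if $x$ has exactly $k$ free occurrences in $a$, replace the $i$-th (left-to-right) by $b_i$; else $0$. Rigid expansion: $T_r(x)=\{x\}$, $T_r(\lambda x.M)=\{\lambda x.a\mid a\in T_r(M)\}$, $T_r(PQ)=\{\langle c\rangle(d_1,\dots,d_n)\mid c\in T_r(P), n\ge0, d_i\in T_r(Q)\}$. Every nonzero rigid term is $\lambda x_1\dots\lambda x_m.\langle\cdots\langle a'\rangle\vec b_1\cdots\rangle\vec b_n$ with $a'$ a variable (then it is a head-normal form) or a redex $\langle\lambda x.c\rangle\vec d$; $0$ is also a head-normal form. $H_r$ fixes head-normal forms and maps $\lambda\vec x.\langle\cdots\langle\langle\lambda x.c\rangle\vec d\rangle\vec d_1\cdots\rangle\vec d_n$ to $\lambda\vec x.\langle\cdots\langle c[\vec d/x]\rangle\vec d_1\cdots\rangle\vec d_n$. For $\lambda$-terms, $M$ is a head-normal form if $M=\lambda x_1\dots\lambda x_m.yN_1\dots N_n$ with $y$ a variable; $H$ fixes head-normal forms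 and maps $\lambda\vec x.(\lambda x.P)QQ_1\dots Q_n$ to $\lambda\vec x.P[Q/x]Q_1\dots Q_n$. -}

module Defs where

open import Data.Nat using (ℕ; zero; suc; _+_; _<ᵇ_; _≡ᵇ_; pred)
open import Data.Bool using (if_then_else_)
open import Data.List using (List; []; _∷_)
open import Data.List.Relation.Unary.All using (All)
open import Data.Maybe using (Maybe; just; nothing; _>>=_)
open import Data.Product using (_×_; _,_)

iter : {A : Set} → ℕ → (A → A) → A → A
iter zero    f x = x
iter (suc m) f x = f (iter m f x)

-- λ-terms (unscoped de Bruijn indices; α-equivalence is syntactic equality)

data Λ : Set where
  var : ℕ → Λ
  lam : Λ → Λ
  app : Λ → Λ → Λ

shift : ℕ → ℕ → Λ → Λ
shift k c (var i) = if i <ᵇ c then var i else var (i + k)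
shift k c (lam M) = lam (shift k (suc c) M)
shift k c (app M N) = app (shift k c M) (shift k c N)

substΛ : ℕ → Λ → Λ → Λ
substΛ d (var i) Q =
  if i <ᵇ d then var i else (if i ≡ᵇ d then shift d 0 Q else var (pred i))
substΛ d (lam P) Q = lam (substΛ (suc d) P Q)
substΛ d (app P P') Q = app (substΛ d P Q) (substΛ d P' Q)

-- P[Q/x] where x is the variable bound by the enclosing λ (index 0)
_[_/0] : Λ → Λ → Λ
P [ Q /0] = substΛ 0 P Q

data Neutral : Λ → Set where
  var : ∀ x → Neutral (var x)
  app : ∀ {M} N → Neutral M → Neutral (app M N)

data HNF : Λ → Set where
  neu : ∀ {M} → Neutral M → HNF M
  lam : ∀ {M} → HNF M → HNF (lam M)

-- head reduction step H (fixes head-normal forms)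
H : Λ → Λ
H (var x) = var x
H (lam M) = lam (H M)
H (app (var x) Q) = app (var x) Q
H (app (lam P) Q) = P [ Q /0]
H (app (app M N) Q) = app (H (app M N)) Q

-- Rigid resource terms.  Nonzero rigid terms are R⁺ (no 0 occurs inside);
-- a rigid term is  Maybe R⁺  with  nothing = 0.  This implements the
-- absorbing laws  λx.0 = 0, ⟨0⟩d⃗ = 0, (…,0,…) = 0.

data R⁺ : Set where
  var : ℕ → R⁺
  lam : R⁺ → R⁺
  app : R⁺ → List R⁺ → R⁺

Rigid : Set
Rigid = Maybe R⁺

mutual
  shiftR : ℕ → ℕ → R⁺ → R⁺
  shiftR k c (var i) = if i <ᵇ c then var i else var (i + k)
  shiftR k c (lam a) = lam (shiftR k (suc c) a)
  shiftR k c (app a ds) = app (shiftR k c a) (shiftRs k c ds)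

  shiftRs : ℕ → ℕ → List R⁺ → List R⁺
  shiftRs k c [] = []
  shiftRs k c (d ∷ ds) = shiftR k c d ∷ shiftRs k c ds

-- substR d a bs : replace, left to right, the occurrences of index d in a
-- by the successive elements of bs; returns the remaining elements,
-- or nothing when bs runs out.
mutual
  substR : ℕ → R⁺ → List R⁺ → Maybe (R⁺ × List R⁺)
  substR d (var i) bs =
    if i <ᵇ d then just (var i , bs)
    else (if i ≡ᵇ d then consume bs else just (var (pred i) , bs))
    where
      consume : List R⁺ → Maybe (R⁺ × List R⁺)
      consume [] = nothing
      consume (b ∷ bs') = just (shiftR d 0 b , bs')
  substR d (lam a) bs with substR (suc d) a bs
  ... | nothing = nothing
  ... | just (a' , bs') = just (lam a' , bs')
  substR d (app a ds) bs with substR d a bs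
  ... | nothing = nothing
  ... | just (a' , bs') with substRs d ds bs'
  ...   | nothing = nothing
  ...   | just (ds' , bs'') = just (app a' ds' , bs'')

  substRs : ℕ → List R⁺ → List R⁺ → Maybe (List R⁺ × List R⁺)
  substRs d [] bs = just ([] , bs)
  substRs d (a ∷ as) bs with substR d a bs
  ... | nothing = nothing
  ... | just (a' , bs') with substRs d as bs'
  ...   | nothing = nothing
  ...   | just (as' , bs'') = just (a' ∷ as' , bs'')

-- rigid substitution a[b⃗/x] (x = index 0): 0 unless x occurs exactly |b⃗| times
_⟦_/0⟧ : R⁺ → List R⁺ → Rigid
a ⟦ bs /0⟧ with substR 0 a bs
... | just (a' , []) = just a'
... | just (a' , _ ∷ _) = nothing
... | nothing = nothing

data NeutralR : R⁺ → Set where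
  var : ∀ x → NeutralR (var x)
  app : ∀ {a} ds → NeutralR a → NeutralR (app a ds)

data HNFR : R⁺ → Set where
  neu : ∀ {a} → NeutralR a → HNFR a
  lam : ∀ {a} → HNFR a → HNFR (lam a)

Hr⁺ : R⁺ → Rigid
Hr⁺ (var x) = just (var x)
Hr⁺ (lam a) = Data.Maybe.map lam (Hr⁺ a)
Hr⁺ (app (var x) ds) = just (app (var x) ds)
Hr⁺ (app (lam c) ds) = c ⟦ ds /0⟧
Hr⁺ (app (app c e) ds) = Data.Maybe.map (λ c' → app c' ds) (Hr⁺ (app c e))

Hr : Rigid → Rigid
Hr nothing = nothing
Hr (just a) = Hr⁺ a

data _∈Tr_ : R⁺ → Λ → Set where
  var : ∀ x → var x ∈Tr var x
  lam : ∀ {a M} → a ∈Tr M → lam a ∈Tr lam M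
  app : ∀ {c ds P Q} → c ∈Tr P → All (_∈Tr Q) ds → app c ds ∈Tr app P Q

module Submission where

-- Rigid expansion is a simulation of head reduction: if a rigid
-- term a belongs to T_r(M) and H_r(a) is nonzero, then H_r(a) ∈ T_r(H M).
-- Iterating, a nonzero H_r^m(a) lies in T_r(H^m M).  Finally, membership in
-- T_r reflects head-normal forms, because the shape λx⃗.⟨…⟨y⟩d⃗₁…⟩d⃗ₙ of a
-- rigid head-normal form dictates the shape λx⃗.y N₁…Nₙ of the λ-term.

open import Defs
open import Data.Nat using (ℕ; zero; suc; _<ᵇ_; _≡ᵇ_)
open import Data.Bool using (true; false)
open import Data.List using ([]; _∷_)
open import Data.List.Relation.Unary.All using (All; []; _∷_)
open import Data.Maybe using (just; nothing)
open import Data.Product using (Σ; _×_; _,_)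
open import Relation.Binary.PropositionalEquality using (_≡_; refl)

-- Needed because
-- substitution under binders shifts the substituted arguments.
mutual
  shift-∈Tr : ∀ k c {b Q} → b ∈Tr Q → shiftR k c b ∈Tr shift k c Q
  shift-∈Tr k c (var i) with i <ᵇ c
  ... | true  = var i
  ... | false = var _
  shift-∈Tr k c (lam b∈Q)       = lam (shift-∈Tr k (suc c) b∈Q)
  shift-∈Tr k c (app b∈P ds∈Q)  = app (shift-∈Tr k c b∈P) (shift-All-∈Tr k c ds∈Q)

  shift-All-∈Tr : ∀ k c {ds Q} → All (_∈Tr Q) ds →
    All (_∈Tr shift k c Q) (shiftRs k c ds)
  shift-All-∈Tr k c []             = []
  shift-All-∈Tr k c (d∈Q ∷ ds∈Q)   = shift-∈Tr k c d∈Q ∷ shift-All-∈Tr k c ds∈Q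

mutual
  subst-∈Tr : ∀ d {a P Q bs a' bs'} → a ∈Tr P → All (_∈Tr Q) bs →
    substR d a bs ≡ just (a' , bs') →
    (a' ∈Tr substΛ d P Q) × All (_∈Tr Q) bs'
  subst-∈Tr d (var i) bs∈Q eq with i <ᵇ d
  subst-∈Tr d (var i) bs∈Q refl       | true  = var i , bs∈Q
  ... | false with i ≡ᵇ d
  subst-∈Tr d (var i) []            () | false | true
  subst-∈Tr d (var i) (b∈Q ∷ bs∈Q) refl | false | true  = shift-∈Tr d 0 b∈Q , bs∈Q
  subst-∈Tr d (var i) bs∈Q          refl | false | false = var _ , bs∈Q
  subst-∈Tr d {lam a} {bs = bs} (lam a∈P) bs∈Q eq with substR (suc d) a bs in e
  subst-∈Tr d {lam a} (lam a∈P) bs∈Q () | nothing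
  subst-∈Tr d {lam a} (lam a∈P) bs∈Q refl | just _
    with subst-∈Tr (suc d) a∈P bs∈Q e
  ... | a'∈P' , rest∈Q = lam a'∈P' , rest∈Q
  subst-∈Tr d {app c ds} {bs = bs} (app c∈P ds∈P) bs∈Q eq with substR d c bs in e
  subst-∈Tr d {app c ds} (app c∈P ds∈P) bs∈Q () | nothing
  ... | just (_ , bs₁) with substRs d ds bs₁ in e₁
  subst-∈Tr d {app c ds} (app c∈P ds∈P) bs∈Q () | just _ | nothing
  subst-∈Tr d {app c ds} (app c∈P ds∈P) bs∈Q refl | just _ | just _
    with subst-∈Tr d c∈P bs∈Q e
  ... | c'∈P' , bs₁∈Q with subst-All-∈Tr d ds∈P bs₁∈Q e₁
  ...   | ds'∈P' , rest∈Q = app c'∈P' ds'∈P' , rest∈Q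

  subst-All-∈Tr : ∀ d {as P Q bs as' bs'} → All (_∈Tr P) as → All (_∈Tr Q) bs →
    substRs d as bs ≡ just (as' , bs') →
    All (_∈Tr substΛ d P Q) as' × All (_∈Tr Q) bs'
  subst-All-∈Tr d [] bs∈Q refl = [] , bs∈Q
  subst-All-∈Tr d {a ∷ as} {bs = bs} (a∈P ∷ as∈P) bs∈Q eq with substR d a bs in e
  subst-All-∈Tr d {a ∷ as} (a∈P ∷ as∈P) bs∈Q () | nothing
  ... | just (_ , bs₁) with substRs d as bs₁ in e₁
  subst-All-∈Tr d {a ∷ as} (a∈P ∷ as∈P) bs∈Q () | just _ | nothing
  subst-All-∈Tr d {a ∷ as} (a∈P ∷ as∈P) bs∈Q refl | just _ | just _
    with subst-∈Tr d a∈P bs∈Q e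
  ... | a'∈P' , bs₁∈Q with subst-All-∈Tr d as∈P bs₁∈Q e₁
  ...   | as'∈P' , rest∈Q = a'∈P' ∷ as'∈P' , rest∈Q

rigidSubst-∈Tr : ∀ {c P Q ds a'} → c ∈Tr P → All (_∈Tr Q) ds →
  c ⟦ ds /0⟧ ≡ just a' → a' ∈Tr (P [ Q /0])
rigidSubst-∈Tr {c} {ds = ds} c∈P ds∈Q eq with substR 0 c ds in e
rigidSubst-∈Tr c∈P ds∈Q refl | just (_ , []) with subst-∈Tr 0 c∈P ds∈Q e
... | a'∈P[Q] , _ = a'∈P[Q]
rigidSubst-∈Tr c∈P ds∈Q () | just (_ , _ ∷ _)
rigidSubst-∈Tr c∈P ds∈Q () | nothing

simulate-Hr⁺ : ∀ {a M a'} → a ∈Tr M → Hr⁺ a ≡ just a' → a' ∈Tr H M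
simulate-Hr⁺ (var x) refl = var x
simulate-Hr⁺ {lam a} (lam a∈M) eq with Hr⁺ a in e
simulate-Hr⁺ (lam a∈M) ()   | nothing
simulate-Hr⁺ (lam a∈M) refl | just _ = lam (simulate-Hr⁺ a∈M e)
simulate-Hr⁺ (app (var x) ds∈Q) refl = app (var x) ds∈Q
simulate-Hr⁺ (app (lam c∈P) ds∈Q) eq = rigidSubst-∈Tr c∈P ds∈Q eq
simulate-Hr⁺ {app (app c e') ds} (app (app c∈P e∈P') ds∈Q) eq with Hr⁺ (app c e') in e
simulate-Hr⁺ (app (app c∈P e∈P') ds∈Q) ()   | nothing
simulate-Hr⁺ (app (app c∈P e∈P') ds∈Q) refl | just _ =
  app (simulate-Hr⁺ (app c∈P e∈P') e) ds∈Q

-- m head steps: a nonzero H_r^m(a) with a ∈ T_r(M) lies in T_r(H^m M).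
-- Since H_r(0) = 0, every intermediate iterate is nonzero as well.
simulate-iter : ∀ m {a M b} → a ∈Tr M →
  iter m Hr (just a) ≡ just b → b ∈Tr iter m H M
simulate-iter zero a∈M refl = a∈M
simulate-iter (suc m) {a} a∈M eq with iter m Hr (just a) in e
simulate-iter (suc m) a∈M () | nothing
simulate-iter (suc m) a∈M eq | just _ = simulate-Hr⁺ (simulate-iter m a∈M e) eq

reflect-Neutral : ∀ {b M} → b ∈Tr M → NeutralR b → Neutral M
reflect-Neutral (var x)          (var .x)  = var x
reflect-Neutral (app c∈P ds∈Q)   (app _ n) = app _ (reflect-Neutral c∈P n)

reflect-HNF : ∀ {b M} → b ∈Tr M → HNFR b → HNF M
reflect-HNF b∈M       (neu n) = neu (reflect-Neutral b∈M n)
reflect-HNF (lam b∈M) (lam h) = lam (reflect-HNF b∈M h)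

mainTheorem4 : (M : Λ) (a : R⁺) (m : ℕ) → a ∈Tr M →
    Σ R⁺ (λ b → (iter m Hr (just a) ≡ just b) × HNFR b) →
    HNF (iter m H M)
mainTheorem4 M a m a∈M (b , Hrᵐa≡b , b-hnf) =
  reflect-HNF (simulate-iter m a∈M Hrᵐa≡b) b-hnf
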